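{- Let $A$ be a finite set of integers, let $h\ge0$ and $s\ge1$ be integers, and suppose that for each integer $j$ there is a set $I_j\subseteq A$ with $|I_j|\le h$. Define $$f(A,s,I)=\sum_{i_1\in A}\ \sum_{\substack{i_2<i_1\\ i_2\in A-I_{i_1}}}\ \sum_{\substack{i_3<i_2\\ i_3\in A-I_{i_1}-I_{i_2}}}\cdots\sum_{\substack{i_s<i_{s-1}\\ i_s\in A-I_{i_1}-\dots-I_{i_{s-1}}}}1.$$ Then $f(A,s,I)\ge\binom{|A|-(s-1)h}{s}$.
   Context: The binomial coefficient $\binom{x}{s}$ for an integer $x<s$ is taken to be $0$. -}

module Defs where

open import Data.Nat using (ℕ; zero; suc; _+_)
open import Data.Integer using (ℤ; _<?_)
import Data.Integer as ℤ
open import Data.List using (List; []; _∷_; _++_; filter; map)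
open import Data.Nat.ListAction using (sum)
open import Data.List.Membership.DecPropositional ℤ._≟_ using (_∉?_)
open import Relation.Nullary using (Dec; yes; no; ¬_)
open import Relation.Nullary.Decidable using (_×-dec_)
open import Data.Product using (_×_)

-- Inner sums of f(A,s,I).
-- chains I A excl b k  =  Σ_{i < b, i ∈ A - excl} chains I A (excl ∪ I_i) i (k-1),
-- with chains … 0 = 1.  'excl' is the union I_{i_1} ∪ … ∪ I_{i_{r}} (as a list).
chains : (ℤ → List ℤ) → List ℤ → List ℤ → ℤ → ℕ → ℕ
chains I A excl b zero    = 1
chains I A excl b (suc k) =
  sum (map (λ i → chains I A (excl ++ I i) i k)
           (filter (λ i → (i <? b) ×-dec (i ∉? excl)) A))

-- For s = 0 the paper's sum is not defined; we set it to 1 (empty product of sums),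
-- but the theorem only uses s ≥ 1.
f : List ℤ → ℕ → (ℤ → List ℤ) → ℕ
f A zero    I = 1
f A (suc k) I = sum (map (λ i₁ → chains I A (I i₁) i₁ k) A)

-- Generalise f to chains I A E b k, the chains below b that avoid E, and induct on the number n
-- of candidates, the elements of A − E below b. Splitting off the largest candidate x, the chains
-- through x continue below x avoiding E ∪ I x, with at least n − 1 − h candidates, and the others
-- are chains below x avoiding E, with n − 1 candidates. Pascal's rule
-- C(n − kh, k + 1) = C(n − 1 − kh, k) + C(n − 1 − kh, k + 1) then closes the induction.
{-# OPTIONS --safe #-}
module Submission where

open import Defs
open import Data.Nat using (ℕ; _≤_; _∸_; _*_)
open import Data.Nat.Combinatorics using (_C_)
open import Data.Integer using (ℤ)
open import Data.List using (List; length)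
open import Data.List.Relation.Unary.Unique.Propositional using (Unique)
open import Data.List.Membership.Propositional using (_∈_)
open import Data.Product using (_×_)

open import Data.Nat using (zero; suc; _+_; z≤n; s≤s; s≤s⁻¹; _<_)
open import Data.Nat.Properties
open import Data.Nat.Combinatorics using (nCk+nC[k+1]≡[n+1]C[k+1])
open import Data.Nat.ListAction using (sum)
open import Data.Nat.ListAction.Properties using (sum-↭)
import Data.Integer as ℤ
import Data.Integer.Properties as ℤ
open import Data.List using ([]; _∷_; _++_; filter; map)
open import Data.List.Properties using (filter-accept; filter-all)
open import Data.List.Relation.Unary.All as All using (All; _∷_)
open import Data.List.Relation.Unary.Any using (here; there)
open import Data.List.Relation.Unary.AllPairs using (_∷_)
import Data.List.Relation.Unary.Unique.Propositional.Properties as Unique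
open import Data.List.Relation.Binary.Subset.Propositional using (_⊆_)
open import Data.List.Relation.Binary.Permutation.Propositional using (_↭_; prep; swap; ↭-refl; ↭-reflexive; ↭-trans)
open import Data.List.Relation.Binary.Permutation.Propositional.Properties using (↭-length; map⁺; shift; ∈-resp-↭)
open import Data.List.Membership.Propositional.Properties using (∈-filter⁺; ∈-filter⁻; ∈-∃++; ∈-++⁻)
open import Data.List.Membership.DecPropositional ℤ._≟_ using (_∈?_; _∉?_; _∉_)
open import Data.List.Extrema ℤ.≤-totalOrder using (max; xs≤max; v≤max⁺; argmax-all)
open import Data.Product using (∃-syntax; _,_; proj₁; proj₂)
open import Data.Sum using (_⊎_; inj₁; inj₂; [_,_]′; fromInj₂)
open import Function using (_⇔_; mk⇔; Equivalence; id)
open import Level using (Level; 0ℓ)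
open import Relation.Nullary using (yes; no; ¬_; contradiction)
open import Relation.Nullary.Decidable using (_×-dec_)
open import Relation.Unary using (Pred; Decidable)
open import Relation.Binary.PropositionalEquality using (_≡_; _≢_; refl; sym; cong; subst)

open Equivalence using (to; from)

module _ {a p q : Level} {A : Set a} {P : Pred A p} {Q : Pred A q} (P? : Decidable P) (Q? : Decidable Q) where

  filter-cong-∈ : ∀ xs → (∀ {x} → x ∈ xs → P x ⇔ Q x) → filter P? xs ≡ filter Q? xs
  filter-cong-∈ [] _ = refl
  filter-cong-∈ (x ∷ xs) P⇔Q with P? x | Q? x
  ... | yes _  | yes _  = cong (x ∷_) (filter-cong-∈ xs (λ x∈ → P⇔Q (there x∈)))
  ... | yes px | no ¬qx = contradiction (to (P⇔Q (here refl)) px) ¬qx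
  ... | no ¬px | yes qx = contradiction (from (P⇔Q (here refl)) qx) ¬px
  ... | no _   | no _   = filter-cong-∈ xs (λ x∈ → P⇔Q (there x∈))

  private
    ⇔-drop-≡ : ∀ {x y} → y ≢ x → P y ⇔ (y ≡ x ⊎ Q y) → P y ⇔ Q y
    ⇔-drop-≡ y≢x P⇔ = mk⇔ (λ py → fromInj₂ (λ y≡x → contradiction y≡x y≢x) (to P⇔ py))
                          (λ qy → from P⇔ (inj₂ qy))

  filter-↭-∷ : ∀ {x xs} → Unique xs → x ∈ xs → ¬ Q x →
               (∀ {y} → y ∈ xs → P y ⇔ (y ≡ x ⊎ Q y)) →
               filter P? xs ↭ x ∷ filter Q? xs
  filter-↭-∷ {x} {_ ∷ ys} (x∉ys ∷ _) (here refl) ¬qx P⇔ with P? x | Q? x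
  ... | _      | yes qx = contradiction qx ¬qx
  ... | no ¬px | _      = contradiction (from (P⇔ (here refl)) (inj₁ refl)) ¬px
  ... | yes _  | no _   = prep x (↭-reflexive (filter-cong-∈ ys
    (λ y∈ → ⇔-drop-≡ (λ y≡x → All.lookup x∉ys y∈ (sym y≡x)) (P⇔ (there y∈)))))
  filter-↭-∷ {x} {y ∷ ys} (y∉ys ∷ ys!) (there x∈ys) ¬qx P⇔ with P? y | Q? y
  ... | yes _  | yes _  =
    ↭-trans (prep y (filter-↭-∷ ys! x∈ys ¬qx (λ y∈ → P⇔ (there y∈)))) (swap y x ↭-refl)
  ... | no _   | no _   = filter-↭-∷ ys! x∈ys ¬qx (λ y∈ → P⇔ (there y∈))
  ... | yes py | no ¬qy = contradiction (to (⇔-drop-≡ (All.lookup y∉ys x∈ys) (P⇔ (here refl))) py) ¬qy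
  ... | no ¬py | yes qy = contradiction (from (P⇔ (here refl)) (inj₂ qy)) ¬py

module _ {a p : Level} {A : Set a} {P : Pred A p} (P? : Decidable P) where

  length-filter-≤-∷ : ∀ x xs → length (filter P? xs) ≤ length (filter P? (x ∷ xs))
  length-filter-≤-∷ x xs with P? x
  ... | yes _ = n≤1+n _
  ... | no _  = ≤-refl

  length-filter-accept : ∀ {x xs} → P x → length (filter P? (x ∷ xs)) ≡ suc (length (filter P? xs))
  length-filter-accept px = cong length (filter-accept P? px)

module _ {a p q r : Level} {A : Set a} {P : Pred A p} {Q : Pred A q} {R : Pred A r}
         (P? : Decidable P) (Q? : Decidable Q) (R? : Decidable R) where

  length-filter-≤-+ : (∀ {x} → P x → Q x ⊎ R x) → ∀ xs →
                      length (filter P? xs) ≤ length (filter Q? xs) + length (filter R? xs)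
  length-filter-≤-+ P⇒Q⊎R [] = z≤n
  length-filter-≤-+ P⇒Q⊎R (x ∷ xs) with ih ← length-filter-≤-+ P⇒Q⊎R xs | P? x
  ... | no _ = ≤-trans ih (+-mono-≤ (length-filter-≤-∷ Q? x xs) (length-filter-≤-∷ R? x xs))
  ... | yes px with P⇒Q⊎R px
  ...   | inj₁ qx rewrite length-filter-accept Q? {xs = xs} qx =
    s≤s (≤-trans ih (+-monoʳ-≤ _ (length-filter-≤-∷ R? x xs)))
  ...   | inj₂ rx rewrite length-filter-accept R? {xs = xs} rx
                      | +-suc (length (filter Q? (x ∷ xs))) (length (filter R? xs)) =
    s≤s (≤-trans ih (+-monoˡ-≤ _ (length-filter-≤-∷ Q? x xs)))

Unique-⊆⇒length≤ : ∀ {a} {A : Set a} {xs ys : List A} → Unique xs → xs ⊆ ys → length xs ≤ length ys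
Unique-⊆⇒length≤ {xs = []} _ _ = z≤n
Unique-⊆⇒length≤ {xs = x ∷ xs} (x∉xs ∷ xs!) xs⊆ys with ∈-∃++ (xs⊆ys (here refl))
... | l , r , refl = begin
    suc (length xs)       ≤⟨ s≤s (Unique-⊆⇒length≤ xs! xs⊆l++r) ⟩
    suc (length (l ++ r)) ≡⟨ ↭-length (shift x l r) ⟨
    length (l ++ x ∷ r)   ∎
  where
    open ≤-Reasoning
    xs⊆l++r : xs ⊆ l ++ r
    xs⊆l++r y∈xs with ∈-resp-↭ (shift x l r) (xs⊆ys (there y∈xs))
    ... | here y≡x = contradiction (sym y≡x) (All.lookup x∉xs y∈xs)
    ... | there y∈ = y∈

[1+m∸t]C[1+k]≤[m∸t]Ck+[m∸t]C[1+k] : ∀ m t k → (suc m ∸ t) C suc k ≤ (m ∸ t) C k + (m ∸ t) C suc k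
[1+m∸t]C[1+k]≤[m∸t]Ck+[m∸t]C[1+k] m t k with t ≤? m
... | yes t≤m rewrite +-∸-assoc 1 t≤m = ≤-reflexive (sym (nCk+nC[k+1]≡[n+1]C[k+1] (m ∸ t) k))
... | no t≰m  rewrite m≤n⇒m∸n≡0 (≰⇒> t≰m) = z≤n

greatest : (xs : List ℤ) → 0 < length xs → ∃[ x ] x ∈ xs × All (ℤ._≤ x) xs
greatest (y ∷ ys) _ =
  max y ys , argmax-all id (here refl) (All.tabulate there) , v≤max⁺ y ys (inj₁ ℤ.≤-refl) ∷ xs≤max y ys

strict-upper-bound : (xs : List ℤ) → ∃[ b ] All (ℤ._< b) xs
strict-upper-bound xs =
  ℤ.suc (max ℤ.0ℤ xs) , All.map (λ x≤ → ℤ.suc[i]≤j⇒i<j (ℤ.suc-mono x≤)) (xs≤max ℤ.0ℤ xs)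

module _ (A : List ℤ) where

  Candidate : List ℤ → ℤ → Pred ℤ 0ℓ
  Candidate E b i = i ℤ.< b × i ∉ E

  candidate? : ∀ E b → Decidable (Candidate E b)
  candidate? E b i = (i ℤ.<? b) ×-dec (i ∉? E)

  candidates : List ℤ → ℤ → List ℤ
  candidates E b = filter (candidate? E b) A

  candidates-below : ∀ {b} → All (ℤ._< b) A → candidates [] b ≡ A
  candidates-below {b} A<b = filter-all (candidate? [] b) (All.map (λ a<b → a<b , λ ()) A<b)

  module _ (A! : Unique A) where

    candidates-↭-greatest : ∀ {E b x} → x ∈ candidates E b → All (ℤ._≤ x) (candidates E b) →
                            candidates E b ↭ x ∷ candidates E x
    candidates-↭-greatest {E} {b} {x} x∈cs cs≤x =
      filter-↭-∷ (candidate? E b) (candidate? E x) A! x∈A (λ (x<x , _) → ℤ.<-irrefl refl x<x) cut-at-x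
      where
        x∈A : x ∈ A
        x∈A = proj₁ (∈-filter⁻ (candidate? E b) {xs = A} x∈cs)
        x-cand : Candidate E b x
        x-cand = proj₂ (∈-filter⁻ (candidate? E b) {xs = A} x∈cs)
        below-x : ∀ {y} → y ∈ A → Candidate E b y → y ≡ x ⊎ Candidate E x y
        below-x {y} y∈A (y<b , y∉E) with y ℤ.≟ x
        ... | yes y≡x = inj₁ y≡x
        ... | no y≢x  =
          inj₂ (ℤ.≤∧≢⇒< (All.lookup cs≤x (∈-filter⁺ (candidate? E b) y∈A (y<b , y∉E))) y≢x , y∉E)
        up-to-x : ∀ {y} → y ≡ x ⊎ Candidate E x y → Candidate E b y
        up-to-x (inj₁ refl)        = x-cand
        up-to-x (inj₂ (y<x , y∉E)) = ℤ.<-trans y<x (proj₁ x-cand) , y∉E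
        cut-at-x : ∀ {y} → y ∈ A → Candidate E b y ⇔ (y ≡ x ⊎ Candidate E x y)
        cut-at-x y∈A = mk⇔ (below-x y∈A) up-to-x

    length-candidates-++ : ∀ E J b → length (candidates E b) ≤ length J + length (candidates (E ++ J) b)
    length-candidates-++ E J b =
      ≤-trans (length-filter-≤-+ (candidate? E b) (_∈? J) (candidate? (E ++ J) b) in-J-or-not A)
              (+-monoˡ-≤ _ (Unique-⊆⇒length≤ (Unique.filter⁺ (_∈? J) A!)
                                               (λ y∈ → proj₂ (∈-filter⁻ (_∈? J) {xs = A} y∈))))
      where
        in-J-or-not : ∀ {y} → Candidate E b y → y ∈ J ⊎ Candidate (E ++ J) b y
        in-J-or-not {y} (y<b , y∉E) with y ∈? J
        ... | yes y∈J = inj₁ y∈J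
        ... | no y∉J  = inj₂ (y<b , λ y∈E++J → [ y∉E , y∉J ]′ (∈-++⁻ E y∈E++J))

    module _ {h : ℕ} (I : ℤ → List ℤ) (|I|≤h : ∀ j → length (I j) ≤ h) where

      mutual
        binomial≤chains : ∀ k n E b → n ≤ length (candidates E b) →
                          (n ∸ k * h) C suc k ≤ chains I A E b (suc k)
        binomial≤chains k zero E b _ rewrite 0∸n≡0 (k * h) = z≤n
        binomial≤chains k (suc n) E b 1+n≤|cs| with greatest (candidates E b) (≤-trans (s≤s z≤n) 1+n≤|cs|)
        ... | x , x∈cs , cs≤x = begin
          (suc n ∸ k * h) C suc k
            ≤⟨ [1+m∸t]C[1+k]≤[m∸t]Ck+[m∸t]C[1+k] n (k * h) k ⟩
          (n ∸ k * h) C k + (n ∸ k * h) C suc k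
            ≤⟨ +-mono-≤ (binomial≤chains-∸h k n (E ++ I x) x n∸h≤) (binomial≤chains k n E x n≤) ⟩
          chains I A (E ++ I x) x k + chains I A E x (suc k)
            ≡⟨ sum-↭ (map⁺ (λ i → chains I A (E ++ I i) i k) cs↭) ⟨
          chains I A E b (suc k)
            ∎
          where
            open ≤-Reasoning
            cs↭ : candidates E b ↭ x ∷ candidates E x
            cs↭ = candidates-↭-greatest x∈cs cs≤x
            n≤ : n ≤ length (candidates E x)
            n≤ = s≤s⁻¹ (subst (suc n ≤_) (↭-length cs↭) 1+n≤|cs|)
            n∸h≤ : n ∸ h ≤ length (candidates (E ++ I x) x)
            n∸h≤ = m≤n+o⇒m∸n≤o n h
                     (≤-trans n≤ (≤-trans (length-candidates-++ E (I x) x) (+-monoˡ-≤ _ (|I|≤h x))))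

        binomial≤chains-∸h : ∀ k n E b → n ∸ h ≤ length (candidates E b) →
                             (n ∸ k * h) C k ≤ chains I A E b k
        binomial≤chains-∸h zero    n E b _ = ≤-refl
        binomial≤chains-∸h (suc k) n E b n∸h≤ rewrite sym (∸-+-assoc n h (k * h)) =
          binomial≤chains k (n ∸ h) E b n∸h≤

f≡chains : ∀ A I k {b} → All (ℤ._< b) A → f A (suc k) I ≡ chains I A [] b (suc k)
f≡chains A I k A<b = cong (λ cs → sum (map (λ i → chains I A (I i) i k) cs)) (sym (candidates-below A A<b))

mainTheorem19 : (A : List ℤ) → Unique A → (h s : ℕ) → 1 ≤ s →
    (I : ℤ → List ℤ) →
    (∀ j → Unique (I j) × (∀ {x} → x ∈ I j → x ∈ A) × length (I j) ≤ h) →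
    ((length A ∸ (s ∸ 1) * h) C s) ≤ f A s I
-- Distinctness of A alone ensures that I j removes at most |I j| candidates, so only |I j| ≤ h is used.
mainTheorem19 A A! h (suc k) _ I hyp with strict-upper-bound A
... | b , A<b rewrite f≡chains A I k A<b =
  binomial≤chains A A! I (λ j → proj₂ (proj₂ (hyp j))) k (length A) [] b
    (≤-reflexive (cong length (sym (candidates-below A A<b))))
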